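{- Let $\Pi$ be the 600-cell and let $P=\Pi/\{\pm1\}$ be its quotient by the fixed-point-free involution $x\mapsto -x$ (a triangulation of real projective 3-space with 60 vertices, 300 tetrahedra, and icosahedral vertex links). Then $B(\Pi)\cong B(P)$, the isomorphism being induced by the covering map $\Pi\to P$.
   Context: The 600-cell $\Pi$ is the boundary complex of the convex hull in $\mathbb{R}^4=\mathbb{H}$ of the 120 unit quaternions of the binary icosahedral group; it triangulates the 3-sphere with 120 vertices, 600 tetrahedra, and icosahedral vertex links, and $x\mapsto -x$ is a simplicial involution of it without fixed points. A five-coloring of a simplicial complex $X$ is a map $f$ from its vertices to $\{1,\dots,5\}$ with adjacent vertices colored differently (colorings differing by renaming colors identified). $B(X)$ is the simplicial complex whose vertices are the distinct sets $f^{ -1}(c)$ ($f$ a five-coloring, $c$ a color) and whose 4-simplices are the sets $\{f^{ -1}(1),\dots,f^{ -1}(5)\}$. -}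

module Defs where

open import Data.Nat as ℕ using (ℕ)
open import Data.Integer as ℤ using (ℤ; +_; -[1+_])
open import Data.Product using (Σ; ∃; ∃-syntax; _×_; _,_; proj₁; proj₂)
open import Data.Sum using (_⊎_; inj₁; inj₂; [_,_])
open import Data.Fin as F using (Fin; zero; suc; #_)
open import Data.Fin.Subset using (Subset)
open import Data.Bool using (Bool)
open import Data.List as List using (List; []; _∷_; _++_; concatMap; length)
open import Data.Vec as Vec using (Vec; []; _∷_)
open import Relation.Nullary using (¬_; does)
open import Relation.Binary.PropositionalEquality using (_≡_; _≢_; refl)
open import Function.Bundles using (_⇔_)

-- Arithmetic in ½ℤ[φ],  φ = (1+√5)/2,  φ² = φ + 1.
-- A pair (a , b) of integers stands for the real number (a + b φ) / 2.

Zφ : Set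
Zφ = ℤ × ℤ

negφ : Zφ → Zφ
negφ (a , b) = (ℤ.- a , ℤ.- b)

-- Quaternions (real part, i, j, k) with coordinates in ½ℤ[φ].
Quat : Set
Quat = Vec Zφ 4

negQ : Quat → Quat
negQ = Vec.map negφ

-- Four times the Euclidean inner product, written again as (c , d) = c + d φ:
-- ((a+bφ)/2)((c+dφ)/2) = ((ac+bd) + (ad+bc+bd)φ)/4.
mul4 : Zφ → Zφ → Zφ
mul4 (a , b) (c , d) = (a ℤ.* c ℤ.+ b ℤ.* d , a ℤ.* d ℤ.+ b ℤ.* c ℤ.+ b ℤ.* d)

addφ : Zφ → Zφ → Zφ
addφ (a , b) (c , d) = (a ℤ.+ c , b ℤ.+ d)

inner4 : Quat → Quat → Zφ
inner4 x y = Vec.foldr (λ _ → Zφ) addφ (+ 0 , + 0) (Vec.zipWith mul4 x y)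

-- The binary icosahedral group (120 unit quaternions), listed as
--   listP ++ map negQ listP,
-- where listP contains exactly one element of each pair {q , -q}.

z0 one two phi phiInv : Zφ
z0     = (+ 0 , + 0)
one    = (+ 1 , + 0)          -- 1/2
two    = (+ 2 , + 0)          -- 1
phi    = (+ 0 , + 1)          -- φ/2
phiInv = (-[1+ 0 ] , + 1)     -- φ⁻¹/2 = (φ - 1)/2

signs : Zφ → List Zφ
signs x = x ∷ negφ x ∷ []

-- ±1, ±i, ±j, ±k : representatives 1, i, j, k
units : List Quat
units = (two ∷ z0 ∷ z0 ∷ z0 ∷ [])
      ∷ (z0 ∷ two ∷ z0 ∷ z0 ∷ [])
      ∷ (z0 ∷ z0 ∷ two ∷ z0 ∷ [])
      ∷ (z0 ∷ z0 ∷ z0 ∷ two ∷ []) ∷ []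

-- (±1 ± i ± j ± k)/2 : representatives with real part +1/2
hurwitz : List Quat
hurwitz = concatMap (λ b → concatMap (λ c → List.map (λ d → one ∷ b ∷ c ∷ d ∷ [])
            (signs one)) (signs one)) (signs one)

-- The 12 even permutations σ of {0,1,2,3}; position k receives value σ k.
evenPerms : List (Vec (Fin 4) 4)
evenPerms =
    (# 0 ∷ # 1 ∷ # 2 ∷ # 3 ∷ []) ∷ (# 0 ∷ # 2 ∷ # 3 ∷ # 1 ∷ []) ∷ (# 0 ∷ # 3 ∷ # 1 ∷ # 2 ∷ [])
  ∷ (# 1 ∷ # 0 ∷ # 3 ∷ # 2 ∷ []) ∷ (# 1 ∷ # 2 ∷ # 0 ∷ # 3 ∷ []) ∷ (# 1 ∷ # 3 ∷ # 2 ∷ # 0 ∷ [])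
  ∷ (# 2 ∷ # 0 ∷ # 1 ∷ # 3 ∷ []) ∷ (# 2 ∷ # 1 ∷ # 3 ∷ # 0 ∷ []) ∷ (# 2 ∷ # 3 ∷ # 0 ∷ # 1 ∷ [])
  ∷ (# 3 ∷ # 0 ∷ # 2 ∷ # 1 ∷ []) ∷ (# 3 ∷ # 1 ∷ # 0 ∷ # 2 ∷ []) ∷ (# 3 ∷ # 2 ∷ # 1 ∷ # 0 ∷ []) ∷ []

-- ½(0 ± 1 ± φ⁻¹ ± φ) with coordinates evenly permuted :
-- representatives with the entry ±1/2 taken positive.
icosian : List Quat
icosian = concatMap (λ σ → concatMap (λ s → List.map (λ t →
            Vec.map (Vec.lookup (z0 ∷ one ∷ s ∷ t ∷ [])) σ)
            (signs phi)) (signs phiInv)) evenPerms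

listP : List Quat
listP = units ++ hurwitz ++ icosian

nP : ℕ
nP = length listP          -- = 60

nΠ : ℕ
nΠ = nP ℕ.+ nP

-- Vertices of Π: index i < nP is listP[i], index nP + i is -listP[i].
vertexΠ : Fin nΠ → Quat
vertexΠ v = [ List.lookup listP , (λ i → negQ (List.lookup listP i)) ] (F.splitAt nP v)

record Graph : Set₁ where
  field
    n   : ℕ
    Adj : Fin n → Fin n → Set
open Graph public

-- 1-skeleton of the 600-cell: edges of the convex hull of the 120 units are the
-- pairs at minimal distance, i.e. with inner product φ/2 (= (0 + 2φ)/4).
Π : Graph
Π = record { n = nΠ ; Adj = λ u v → inner4 (vertexΠ u) (vertexΠ v) ≡ (+ 0 , + 2) }

cover : Fin nΠ → Fin nP
cover v = [ (λ i → i) , (λ i → i) ] (F.splitAt nP v)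

P : Graph
P = record { n = nP ; Adj = λ i j → ∃[ u ] ∃[ v ] (cover u ≡ i × cover v ≡ j × Adj Π u v) }

FiveColoring : Graph → Set
FiveColoring G = Σ (Fin (n G) → Fin 5) λ f → ∀ u v → Adj G u v → f u ≢ f v

colorClass : (G : Graph) → FiveColoring G → Fin 5 → Subset (n G)
colorClass G (f , _) c = Vec.tabulate (λ v → does (f v F.≟ c))

BVertex : (G : Graph) → Subset (n G) → Set
BVertex G S = ∃[ f ] ∃[ c ] S ≡ colorClass G f c

-- 4-simplices of B(G); a set of vertices of B(G) is given as a predicate σ.
-- σ is a 4-simplex iff σ = {f⁻¹(1),…,f⁻¹(5)} for some five-coloring f.
BFacet : (G : Graph) → (Subset (n G) → Set) → Set
BFacet G σ = ∃[ f ] ∀ S → (σ S ⇔ (∃[ c ] S ≡ colorClass G f c))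

preimage : Subset nP → Subset nΠ
preimage S = Vec.tabulate (λ v → Vec.lookup S (cover v))

imageSet : (Subset nP → Set) → (Subset nΠ → Set)
imageSet σ T = ∃[ S ] (σ S × preimage S ≡ T)

-- S ↦ cover⁻¹(S) is a simplicial isomorphism B(P) ≅ B(Π): it maps vertices to
-- vertices, bijectively, and a set of vertices of B(P) is a 4-simplex iff its
-- image is a 4-simplex of B(Π) (both complexes are generated by their 4-simplices).
record InducedIsoB : Set₁ where
  field
    vertex-map   : ∀ S → BVertex P S → BVertex Π (preimage S)
    vertex-inj   : ∀ S S′ → BVertex P S → BVertex P S′ → preimage S ≡ preimage S′ → S ≡ S′
    vertex-surj  : ∀ T → BVertex Π T → ∃[ S ] (BVertex P S × preimage S ≡ T)
    facet-iff    : (σ : Subset nP → Set) → (∀ S → σ S → BVertex P S) →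
                   BFacet P σ ⇔ BFacet Π (imageSet σ)

private
  sizeP : nP ≡ 60
  sizeP = refl

module Submission where

-- Every five-coloring of the 600-cell is invariant under x ↦ -x. Hence five-colorings of Π are
-- exactly the pull-backs of five-colorings of P along the covering map, and the color classes of
-- the pull-back are the preimages of the color classes downstairs, which gives B(Π) ≅ B(P).
-- The invariance is established by exhaustive search: after renaming colors so that a fixed
-- tetrahedron is colored 0, 1, 2, 3, a depth-first search over the remaining vertices finds only
-- ten five-colorings, each of them antipodal.

open import Defs
open import Data.Bool using (Bool; true; false; T; _∨_)
open import Data.Bool.ListAction using (all)
open import Data.Bool.Properties using (T-∨; T-≡)
open import Data.Empty using (⊥-elim)
open import Data.Fin as F using (Fin; zero; suc; #_; _↑ˡ_; _↑ʳ_)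
open import Data.Fin.Permutation as Perm using (Permutation′; _⟨$⟩ʳ_; _⟨$⟩ˡ_; _∘ₚ_; inverseˡ)
import Data.Fin.Permutation.Components as PC
import Data.Fin.Properties as FP
open import Data.List as List using (List; []; _∷_; allFin)
open import Data.List.Membership.Propositional using (_∉_)
open import Data.List.Membership.Propositional.Properties using (∈-map⁻)
open import Data.List.Relation.Unary.All as All using (All)
open import Data.List.Relation.Unary.All.Properties using (all⁺; tabulate⁻)
open import Data.Maybe using (Maybe; just; nothing)
open import Data.Maybe.Properties as MaybeP using (just-injective)
open import Data.Nat using (ℕ)
open import Data.Integer as ℤ using (+_)
open import Data.Product using (Σ; ∃-syntax; _,_; proj₁; proj₂)
import Data.Product.Properties as ×P
open import Data.Sum using (inj₁; inj₂; [_,_]′)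
open import Data.Vec using (Vec; []; _∷_; lookup; tabulate; replicate; _[_]≔_)
import Data.Vec.Properties as VecP
open import Function using (_∘_; id; Injective)
open import Function.Bundles using (mk⇔; Equivalence)
open import Relation.Binary using (Decidable)
open import Relation.Binary.PropositionalEquality
open import Relation.Nullary using (Dec; yes; no; does; ¬?)
open import Relation.Nullary.Decidable using (⌊_⌋; toWitness; dec-true; dec-false; _→-dec_)

transpose-sends : ∀ {k} (i j : Fin k) → PC.transpose i j i ≡ j
transpose-sends i j rewrite dec-true (i F.≟ i) refl = refl

transpose-fixes : ∀ {k} {i j l : Fin k} → l ≢ i → l ≢ j → PC.transpose i j l ≡ l
transpose-fixes {i = i} {j} {l} l≢i l≢j
  rewrite dec-false (l F.≟ i) l≢i | dec-false (l F.≟ j) l≢j = refl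

⟨$⟩ʳ-injective : ∀ {k} (ρ : Permutation′ k) → Injective _≡_ _≡_ (ρ ⟨$⟩ʳ_)
⟨$⟩ʳ-injective ρ e = trans (sym (inverseˡ ρ)) (trans (cong (ρ ⟨$⟩ˡ_) e) (inverseˡ ρ))

-- Induction on m, correcting the image of the new point by a transposition.
permutation-extending : ∀ {m k} (x y : Fin m → Fin k) →
                        Injective _≡_ _≡_ x → Injective _≡_ _≡_ y →
                        Σ (Permutation′ k) λ ρ → ∀ i → ρ ⟨$⟩ʳ x i ≡ y i
permutation-extending {ℕ.zero} x y _ _ = Perm.id , λ ()
permutation-extending {ℕ.suc m} {k} x y x-inj y-inj = ρ ∘ₚ τ , sends
  where
  extension : Σ (Permutation′ k) λ ρ → ∀ i → ρ ⟨$⟩ʳ x (suc i) ≡ y (suc i)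
  extension = permutation-extending (x ∘ suc) (y ∘ suc) (FP.suc-injective ∘ x-inj) (FP.suc-injective ∘ y-inj)
  ρ : Permutation′ k
  ρ = proj₁ extension
  ρx≡y : ∀ i → ρ ⟨$⟩ʳ x (suc i) ≡ y (suc i)
  ρx≡y = proj₂ extension
  τ : Permutation′ k
  τ = Perm.transpose (ρ ⟨$⟩ʳ x zero) (y zero)
  sends : ∀ i → τ ⟨$⟩ʳ (ρ ⟨$⟩ʳ x i) ≡ y i
  sends zero    = transpose-sends (ρ ⟨$⟩ʳ x zero) (y zero)
  sends (suc i) = trans (cong (τ ⟨$⟩ʳ_) (ρx≡y i)) (transpose-fixes y≢ρx₀ y≢y₀)
    where
    y≢ρx₀ : y (suc i) ≢ ρ ⟨$⟩ʳ x zero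
    y≢ρx₀ e with () ← x-inj (⟨$⟩ʳ-injective ρ (trans (ρx≡y i) e))
    y≢y₀ : y (suc i) ≢ y zero
    y≢y₀ e with () ← y-inj e

all-allFin : ∀ {m} (p : Fin m → Bool) → T (all p (allFin m)) → ∀ i → T (p i)
all-allFin {m} p ok = tabulate⁻ (all⁺ p (allFin m) ok)

decided : ∀ {a} {A : Set a} (a? : Dec A) → ⌊ a? ⌋ ≡ true → A
decided a? ok = toWitness (Equivalence.from T-≡ ok)

Proper : (G : Graph) {k : ℕ} → (Fin (n G) → Fin k) → Set
Proper G f = ∀ u v → Adj G u v → f u ≢ f v

proper-injective-on-clique : ∀ (G : Graph) {k m} {f : Fin (n G) → Fin k} → Proper G f →
                             (x : Fin m → Fin (n G)) → (∀ i j → i ≢ j → Adj G (x i) (x j)) →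
                             Injective _≡_ _≡_ (f ∘ x)
proper-injective-on-clique G proper x clique {i} {j} e with i F.≟ j
... | yes i≡j = i≡j
... | no i≢j  = ⊥-elim (proper (x i) (x j) (clique i j i≢j) e)

module ColoringSearch (G : Graph) (k : ℕ)
  (neighbors : Vec (List (Fin (n G))) (n G))
  (neighbors-adjacent : ∀ v → All (Adj G v) (lookup neighbors v)) where

  open import Data.List.Membership.DecPropositional (MaybeP.≡-dec (F._≟_ {k})) using (_∈?_)

  PartialColoring : Set
  PartialColoring = Vec (Maybe (Fin k)) (n G)

  _Extends_ : (Fin (n G) → Fin k) → PartialColoring → Set
  f Extends K = ∀ v c → lookup K v ≡ just c → f v ≡ c

  extends-update : ∀ {f K v c} → f Extends K → f v ≡ c → f Extends (K [ v ]≔ just c)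
  extends-update {K = K} {v} {c} ext fv≡c w c′ e with w F.≟ v
  ... | yes refl = trans fv≡c (just-injective (trans (sym (VecP.lookup∘update v K (just c))) e))
  ... | no w≢v   = ext w c′ (trans (sym (VecP.lookup∘update′ w≢v K (just c))) e)

  seed : ∀ {m} → (Fin m → Fin (n G)) → (Fin m → Fin k) → PartialColoring
  seed {ℕ.zero}  x c = replicate (n G) nothing
  seed {ℕ.suc m} x c = seed (x ∘ suc) (c ∘ suc) [ x zero ]≔ just (c zero)

  extends-seed : ∀ {m f} (x : Fin m → Fin (n G)) (c : Fin m → Fin k) →
                 (∀ i → f (x i) ≡ c i) → f Extends seed x c
  extends-seed {ℕ.zero}  x c _ v c′ e with () ← trans (sym (VecP.lookup-replicate v nothing)) e
  extends-seed {ℕ.suc m} x c fx≡c =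
    extends-update {K = seed (x ∘ suc) (c ∘ suc)} (extends-seed (x ∘ suc) (c ∘ suc) (fx≡c ∘ suc)) (fx≡c zero)

  colorsAround : PartialColoring → Fin (n G) → List (Maybe (Fin k))
  colorsAround K v = List.map (lookup K) (lookup neighbors v)

  color-not-around : ∀ {f K} → Proper G f → f Extends K → ∀ v → just (f v) ∉ colorsAround K v
  color-not-around {K = K} proper ext v fv∈ with ∈-map⁻ (lookup K) fv∈
  ... | w , w∈ , e = proper v w (All.lookup (neighbors-adjacent v) w∈) (sym (ext w _ (sym e)))

  mutual
    everyExtension : (PartialColoring → Bool) → List (Fin (n G)) → PartialColoring → Bool
    everyExtension test []       K = test K
    everyExtension test (v ∷ vs) K = all (tryColor test vs K v (colorsAround K v)) (allFin k)

    -- the neighbors' colors are an argument so that they are computed once, not once per color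
    tryColor : (PartialColoring → Bool) → List (Fin (n G)) → PartialColoring → Fin (n G) →
                List (Maybe (Fin k)) → Fin k → Bool
    tryColor test vs K v used c = ⌊ just c ∈? used ⌋ ∨ everyExtension test vs (K [ v ]≔ just c)

  everyExtension-sound : (Q : (Fin (n G) → Fin k) → Set) (test : PartialColoring → Bool) →
                         (∀ {f} K → f Extends K → T (test K) → Q f) →
                         ∀ {f} → Proper G f → ∀ vs K → f Extends K → everyExtension test vs K ≡ true → Q f
  everyExtension-sound Q test test-sound proper [] K ext ok = test-sound K ext (Equivalence.from T-≡ ok)
  everyExtension-sound Q test test-sound {f} proper (v ∷ vs) K ext ok
    with Equivalence.to (T-∨ {⌊ just (f v) ∈? colorsAround K v ⌋})
           (all-allFin (tryColor test vs K v (colorsAround K v)) (Equivalence.from T-≡ ok) (f v))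
  ... | inj₁ used = ⊥-elim (color-not-around {K = K} proper ext v
                              (toWitness {a? = just (f v) ∈? colorsAround K v} used))
  ... | inj₂ rest = everyExtension-sound Q test test-sound proper vs (K [ v ]≔ just (f v))
                      (extends-update {K = K} ext refl) (Equivalence.to T-≡ rest)

  sameKnownColor : Maybe (Fin k) → Maybe (Fin k) → Bool
  sameKnownColor (just a) (just b) = ⌊ a F.≟ b ⌋
  sameKnownColor _        _        = false

  sameKnownColor-sound : ∀ {f K} → f Extends K → ∀ u v →
                          T (sameKnownColor (lookup K u) (lookup K v)) → f u ≡ f v
  sameKnownColor-sound {K = K} ext u v ok with lookup K u in eu | lookup K v in ev
  ... | just a | just b = trans (ext u a eu) (trans (toWitness {a? = a F.≟ b} ok) (sym (ext v b ev)))

adjacentΠ? : Decidable (Adj Π)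
adjacentΠ? u v = ×P.≡-dec ℤ._≟_ ℤ._≟_ (inner4 (vertexΠ u) (vertexΠ v)) (+ 0 , + 2)

neighborsΠ : Vec (List (Fin nΠ)) nΠ
neighborsΠ =
    (# 48 ∷ # 50 ∷ # 52 ∷ # 54 ∷ # 56 ∷ # 58 ∷ # 109 ∷ # 111 ∷ # 113 ∷ # 115 ∷ # 117 ∷ # 119 ∷ [])
  ∷ (# 20 ∷ # 22 ∷ # 32 ∷ # 34 ∷ # 44 ∷ # 46 ∷ # 81 ∷ # 83 ∷ # 93 ∷ # 95 ∷ # 105 ∷ # 107 ∷ [])
  ∷ (# 16 ∷ # 18 ∷ # 24 ∷ # 26 ∷ # 40 ∷ # 42 ∷ # 77 ∷ # 79 ∷ # 85 ∷ # 87 ∷ # 101 ∷ # 103 ∷ [])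
  ∷ (# 12 ∷ # 14 ∷ # 28 ∷ # 30 ∷ # 36 ∷ # 38 ∷ # 73 ∷ # 75 ∷ # 89 ∷ # 91 ∷ # 97 ∷ # 99 ∷ [])
  ∷ (# 12 ∷ # 16 ∷ # 20 ∷ # 24 ∷ # 28 ∷ # 32 ∷ # 36 ∷ # 40 ∷ # 44 ∷ # 48 ∷ # 52 ∷ # 56 ∷ [])
  ∷ (# 13 ∷ # 22 ∷ # 26 ∷ # 29 ∷ # 32 ∷ # 37 ∷ # 40 ∷ # 54 ∷ # 56 ∷ # 79 ∷ # 107 ∷ # 111 ∷ [])
  ∷ (# 14 ∷ # 17 ∷ # 25 ∷ # 28 ∷ # 34 ∷ # 41 ∷ # 44 ∷ # 50 ∷ # 52 ∷ # 83 ∷ # 99 ∷ # 119 ∷ [])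
  ∷ (# 15 ∷ # 27 ∷ # 29 ∷ # 34 ∷ # 41 ∷ # 54 ∷ # 78 ∷ # 81 ∷ # 98 ∷ # 107 ∷ # 109 ∷ # 119 ∷ [])
  ∷ (# 18 ∷ # 21 ∷ # 24 ∷ # 30 ∷ # 33 ∷ # 36 ∷ # 45 ∷ # 48 ∷ # 58 ∷ # 75 ∷ # 103 ∷ # 115 ∷ [])
  ∷ (# 23 ∷ # 26 ∷ # 31 ∷ # 33 ∷ # 37 ∷ # 58 ∷ # 74 ∷ # 77 ∷ # 103 ∷ # 106 ∷ # 111 ∷ # 113 ∷ [])
  ∷ (# 19 ∷ # 25 ∷ # 30 ∷ # 35 ∷ # 45 ∷ # 50 ∷ # 73 ∷ # 82 ∷ # 99 ∷ # 102 ∷ # 115 ∷ # 117 ∷ [])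
  ∷ (# 27 ∷ # 31 ∷ # 35 ∷ # 72 ∷ # 76 ∷ # 80 ∷ # 98 ∷ # 102 ∷ # 106 ∷ # 109 ∷ # 113 ∷ # 117 ∷ [])
  ∷ (# 3 ∷ # 4 ∷ # 14 ∷ # 16 ∷ # 20 ∷ # 28 ∷ # 36 ∷ # 38 ∷ # 44 ∷ # 46 ∷ # 71 ∷ # 91 ∷ [])
  ∷ (# 5 ∷ # 15 ∷ # 22 ∷ # 29 ∷ # 37 ∷ # 39 ∷ # 63 ∷ # 70 ∷ # 79 ∷ # 90 ∷ # 105 ∷ # 107 ∷ [])
  ∷ (# 3 ∷ # 6 ∷ # 12 ∷ # 17 ∷ # 28 ∷ # 44 ∷ # 46 ∷ # 69 ∷ # 83 ∷ # 91 ∷ # 97 ∷ # 99 ∷ [])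
  ∷ (# 7 ∷ # 13 ∷ # 29 ∷ # 63 ∷ # 68 ∷ # 78 ∷ # 81 ∷ # 90 ∷ # 96 ∷ # 98 ∷ # 105 ∷ # 107 ∷ [])
  ∷ (# 2 ∷ # 4 ∷ # 12 ∷ # 18 ∷ # 20 ∷ # 24 ∷ # 36 ∷ # 38 ∷ # 40 ∷ # 42 ∷ # 71 ∷ # 87 ∷ [])
  ∷ (# 6 ∷ # 14 ∷ # 19 ∷ # 25 ∷ # 41 ∷ # 43 ∷ # 62 ∷ # 69 ∷ # 83 ∷ # 86 ∷ # 97 ∷ # 99 ∷ [])
  ∷ (# 2 ∷ # 8 ∷ # 16 ∷ # 21 ∷ # 24 ∷ # 36 ∷ # 38 ∷ # 67 ∷ # 75 ∷ # 87 ∷ # 101 ∷ # 103 ∷ [])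
  ∷ (# 10 ∷ # 17 ∷ # 25 ∷ # 62 ∷ # 65 ∷ # 73 ∷ # 82 ∷ # 86 ∷ # 97 ∷ # 99 ∷ # 100 ∷ # 102 ∷ [])
  ∷ (# 1 ∷ # 4 ∷ # 12 ∷ # 16 ∷ # 22 ∷ # 32 ∷ # 40 ∷ # 42 ∷ # 44 ∷ # 46 ∷ # 71 ∷ # 95 ∷ [])
  ∷ (# 8 ∷ # 18 ∷ # 23 ∷ # 33 ∷ # 45 ∷ # 47 ∷ # 61 ∷ # 67 ∷ # 75 ∷ # 94 ∷ # 101 ∷ # 103 ∷ [])
  ∷ (# 1 ∷ # 5 ∷ # 13 ∷ # 20 ∷ # 32 ∷ # 40 ∷ # 42 ∷ # 70 ∷ # 79 ∷ # 95 ∷ # 105 ∷ # 107 ∷ [])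
  ∷ (# 9 ∷ # 21 ∷ # 33 ∷ # 61 ∷ # 66 ∷ # 74 ∷ # 77 ∷ # 94 ∷ # 101 ∷ # 103 ∷ # 104 ∷ # 106 ∷ [])
  ∷ (# 2 ∷ # 4 ∷ # 8 ∷ # 16 ∷ # 18 ∷ # 26 ∷ # 36 ∷ # 40 ∷ # 48 ∷ # 56 ∷ # 58 ∷ # 103 ∷ [])
  ∷ (# 6 ∷ # 10 ∷ # 17 ∷ # 19 ∷ # 27 ∷ # 41 ∷ # 50 ∷ # 62 ∷ # 99 ∷ # 102 ∷ # 117 ∷ # 119 ∷ [])
  ∷ (# 2 ∷ # 5 ∷ # 9 ∷ # 24 ∷ # 37 ∷ # 40 ∷ # 56 ∷ # 58 ∷ # 77 ∷ # 79 ∷ # 103 ∷ # 111 ∷ [])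
  ∷ (# 7 ∷ # 11 ∷ # 25 ∷ # 41 ∷ # 62 ∷ # 76 ∷ # 78 ∷ # 98 ∷ # 102 ∷ # 109 ∷ # 117 ∷ # 119 ∷ [])
  ∷ (# 3 ∷ # 4 ∷ # 6 ∷ # 12 ∷ # 14 ∷ # 30 ∷ # 36 ∷ # 44 ∷ # 48 ∷ # 50 ∷ # 52 ∷ # 99 ∷ [])
  ∷ (# 5 ∷ # 7 ∷ # 13 ∷ # 15 ∷ # 31 ∷ # 37 ∷ # 54 ∷ # 63 ∷ # 98 ∷ # 107 ∷ # 109 ∷ # 111 ∷ [])
  ∷ (# 3 ∷ # 8 ∷ # 10 ∷ # 28 ∷ # 36 ∷ # 45 ∷ # 48 ∷ # 50 ∷ # 73 ∷ # 75 ∷ # 99 ∷ # 115 ∷ [])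
  ∷ (# 9 ∷ # 11 ∷ # 29 ∷ # 37 ∷ # 63 ∷ # 72 ∷ # 74 ∷ # 98 ∷ # 106 ∷ # 109 ∷ # 111 ∷ # 113 ∷ [])
  ∷ (# 1 ∷ # 4 ∷ # 5 ∷ # 20 ∷ # 22 ∷ # 34 ∷ # 40 ∷ # 44 ∷ # 52 ∷ # 54 ∷ # 56 ∷ # 107 ∷ [])
  ∷ (# 8 ∷ # 9 ∷ # 21 ∷ # 23 ∷ # 35 ∷ # 45 ∷ # 58 ∷ # 61 ∷ # 103 ∷ # 106 ∷ # 113 ∷ # 115 ∷ [])
  ∷ (# 1 ∷ # 6 ∷ # 7 ∷ # 32 ∷ # 41 ∷ # 44 ∷ # 52 ∷ # 54 ∷ # 81 ∷ # 83 ∷ # 107 ∷ # 119 ∷ [])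
  ∷ (# 10 ∷ # 11 ∷ # 33 ∷ # 45 ∷ # 61 ∷ # 80 ∷ # 82 ∷ # 102 ∷ # 106 ∷ # 113 ∷ # 115 ∷ # 117 ∷ [])
  ∷ (# 3 ∷ # 4 ∷ # 8 ∷ # 12 ∷ # 16 ∷ # 18 ∷ # 24 ∷ # 28 ∷ # 30 ∷ # 38 ∷ # 48 ∷ # 75 ∷ [])
  ∷ (# 5 ∷ # 9 ∷ # 13 ∷ # 26 ∷ # 29 ∷ # 31 ∷ # 39 ∷ # 63 ∷ # 74 ∷ # 77 ∷ # 79 ∷ # 111 ∷ [])
  ∷ (# 3 ∷ # 12 ∷ # 16 ∷ # 18 ∷ # 36 ∷ # 49 ∷ # 67 ∷ # 71 ∷ # 75 ∷ # 87 ∷ # 89 ∷ # 91 ∷ [])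
  ∷ (# 13 ∷ # 37 ∷ # 63 ∷ # 66 ∷ # 70 ∷ # 74 ∷ # 77 ∷ # 79 ∷ # 85 ∷ # 88 ∷ # 90 ∷ # 110 ∷ [])
  ∷ (# 2 ∷ # 4 ∷ # 5 ∷ # 16 ∷ # 20 ∷ # 22 ∷ # 24 ∷ # 26 ∷ # 32 ∷ # 42 ∷ # 56 ∷ # 79 ∷ [])
  ∷ (# 6 ∷ # 7 ∷ # 17 ∷ # 25 ∷ # 27 ∷ # 34 ∷ # 43 ∷ # 62 ∷ # 78 ∷ # 81 ∷ # 83 ∷ # 119 ∷ [])
  ∷ (# 2 ∷ # 16 ∷ # 20 ∷ # 22 ∷ # 40 ∷ # 57 ∷ # 70 ∷ # 71 ∷ # 79 ∷ # 85 ∷ # 87 ∷ # 95 ∷ [])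
  ∷ (# 17 ∷ # 41 ∷ # 62 ∷ # 68 ∷ # 69 ∷ # 78 ∷ # 81 ∷ # 83 ∷ # 84 ∷ # 86 ∷ # 93 ∷ # 118 ∷ [])
  ∷ (# 1 ∷ # 4 ∷ # 6 ∷ # 12 ∷ # 14 ∷ # 20 ∷ # 28 ∷ # 32 ∷ # 34 ∷ # 46 ∷ # 52 ∷ # 83 ∷ [])
  ∷ (# 8 ∷ # 10 ∷ # 21 ∷ # 30 ∷ # 33 ∷ # 35 ∷ # 47 ∷ # 61 ∷ # 73 ∷ # 75 ∷ # 82 ∷ # 115 ∷ [])
  ∷ (# 1 ∷ # 12 ∷ # 14 ∷ # 20 ∷ # 44 ∷ # 53 ∷ # 69 ∷ # 71 ∷ # 83 ∷ # 91 ∷ # 93 ∷ # 95 ∷ [])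
  ∷ (# 21 ∷ # 45 ∷ # 61 ∷ # 65 ∷ # 67 ∷ # 73 ∷ # 75 ∷ # 82 ∷ # 89 ∷ # 92 ∷ # 94 ∷ # 114 ∷ [])
  ∷ (# 0 ∷ # 4 ∷ # 8 ∷ # 24 ∷ # 28 ∷ # 30 ∷ # 36 ∷ # 50 ∷ # 52 ∷ # 56 ∷ # 58 ∷ # 115 ∷ [])
  ∷ (# 38 ∷ # 51 ∷ # 53 ∷ # 57 ∷ # 59 ∷ # 60 ∷ # 67 ∷ # 71 ∷ # 87 ∷ # 89 ∷ # 91 ∷ # 114 ∷ [])
  ∷ (# 0 ∷ # 6 ∷ # 10 ∷ # 25 ∷ # 28 ∷ # 30 ∷ # 48 ∷ # 52 ∷ # 99 ∷ # 115 ∷ # 117 ∷ # 119 ∷ [])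
  ∷ (# 49 ∷ # 53 ∷ # 60 ∷ # 65 ∷ # 69 ∷ # 86 ∷ # 89 ∷ # 91 ∷ # 97 ∷ # 114 ∷ # 116 ∷ # 118 ∷ [])
  ∷ (# 0 ∷ # 4 ∷ # 6 ∷ # 28 ∷ # 32 ∷ # 34 ∷ # 44 ∷ # 48 ∷ # 50 ∷ # 54 ∷ # 56 ∷ # 119 ∷ [])
  ∷ (# 46 ∷ # 49 ∷ # 51 ∷ # 55 ∷ # 57 ∷ # 60 ∷ # 69 ∷ # 71 ∷ # 91 ∷ # 93 ∷ # 95 ∷ # 118 ∷ [])
  ∷ (# 0 ∷ # 5 ∷ # 7 ∷ # 29 ∷ # 32 ∷ # 34 ∷ # 52 ∷ # 56 ∷ # 107 ∷ # 109 ∷ # 111 ∷ # 119 ∷ [])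
  ∷ (# 53 ∷ # 57 ∷ # 60 ∷ # 68 ∷ # 70 ∷ # 90 ∷ # 93 ∷ # 95 ∷ # 105 ∷ # 108 ∷ # 110 ∷ # 118 ∷ [])
  ∷ (# 0 ∷ # 4 ∷ # 5 ∷ # 24 ∷ # 26 ∷ # 32 ∷ # 40 ∷ # 48 ∷ # 52 ∷ # 54 ∷ # 58 ∷ # 111 ∷ [])
  ∷ (# 42 ∷ # 49 ∷ # 53 ∷ # 55 ∷ # 59 ∷ # 60 ∷ # 70 ∷ # 71 ∷ # 85 ∷ # 87 ∷ # 95 ∷ # 110 ∷ [])
  ∷ (# 0 ∷ # 8 ∷ # 9 ∷ # 24 ∷ # 26 ∷ # 33 ∷ # 48 ∷ # 56 ∷ # 103 ∷ # 111 ∷ # 113 ∷ # 115 ∷ [])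
  ∷ (# 49 ∷ # 57 ∷ # 60 ∷ # 66 ∷ # 67 ∷ # 85 ∷ # 87 ∷ # 94 ∷ # 101 ∷ # 110 ∷ # 112 ∷ # 114 ∷ [])
  ∷ (# 49 ∷ # 51 ∷ # 53 ∷ # 55 ∷ # 57 ∷ # 59 ∷ # 108 ∷ # 110 ∷ # 112 ∷ # 114 ∷ # 116 ∷ # 118 ∷ [])
  ∷ (# 21 ∷ # 23 ∷ # 33 ∷ # 35 ∷ # 45 ∷ # 47 ∷ # 80 ∷ # 82 ∷ # 92 ∷ # 94 ∷ # 104 ∷ # 106 ∷ [])
  ∷ (# 17 ∷ # 19 ∷ # 25 ∷ # 27 ∷ # 41 ∷ # 43 ∷ # 76 ∷ # 78 ∷ # 84 ∷ # 86 ∷ # 100 ∷ # 102 ∷ [])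
  ∷ (# 13 ∷ # 15 ∷ # 29 ∷ # 31 ∷ # 37 ∷ # 39 ∷ # 72 ∷ # 74 ∷ # 88 ∷ # 90 ∷ # 96 ∷ # 98 ∷ [])
  ∷ (# 72 ∷ # 76 ∷ # 80 ∷ # 84 ∷ # 88 ∷ # 92 ∷ # 96 ∷ # 100 ∷ # 104 ∷ # 108 ∷ # 112 ∷ # 116 ∷ [])
  ∷ (# 19 ∷ # 47 ∷ # 51 ∷ # 73 ∷ # 82 ∷ # 86 ∷ # 89 ∷ # 92 ∷ # 97 ∷ # 100 ∷ # 114 ∷ # 116 ∷ [])
  ∷ (# 23 ∷ # 39 ∷ # 59 ∷ # 74 ∷ # 77 ∷ # 85 ∷ # 88 ∷ # 94 ∷ # 101 ∷ # 104 ∷ # 110 ∷ # 112 ∷ [])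
  ∷ (# 18 ∷ # 21 ∷ # 38 ∷ # 47 ∷ # 49 ∷ # 59 ∷ # 75 ∷ # 87 ∷ # 89 ∷ # 94 ∷ # 101 ∷ # 114 ∷ [])
  ∷ (# 15 ∷ # 43 ∷ # 55 ∷ # 78 ∷ # 81 ∷ # 84 ∷ # 90 ∷ # 93 ∷ # 96 ∷ # 105 ∷ # 108 ∷ # 118 ∷ [])
  ∷ (# 14 ∷ # 17 ∷ # 43 ∷ # 46 ∷ # 51 ∷ # 53 ∷ # 83 ∷ # 86 ∷ # 91 ∷ # 93 ∷ # 97 ∷ # 118 ∷ [])
  ∷ (# 13 ∷ # 22 ∷ # 39 ∷ # 42 ∷ # 55 ∷ # 57 ∷ # 79 ∷ # 85 ∷ # 90 ∷ # 95 ∷ # 105 ∷ # 110 ∷ [])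
  ∷ (# 12 ∷ # 16 ∷ # 20 ∷ # 38 ∷ # 42 ∷ # 46 ∷ # 49 ∷ # 53 ∷ # 57 ∷ # 87 ∷ # 91 ∷ # 95 ∷ [])
  ∷ (# 11 ∷ # 31 ∷ # 63 ∷ # 64 ∷ # 74 ∷ # 76 ∷ # 80 ∷ # 88 ∷ # 96 ∷ # 98 ∷ # 104 ∷ # 106 ∷ [])
  ∷ (# 3 ∷ # 10 ∷ # 19 ∷ # 30 ∷ # 45 ∷ # 47 ∷ # 65 ∷ # 75 ∷ # 82 ∷ # 89 ∷ # 97 ∷ # 99 ∷ [])
  ∷ (# 9 ∷ # 23 ∷ # 31 ∷ # 37 ∷ # 39 ∷ # 63 ∷ # 66 ∷ # 72 ∷ # 77 ∷ # 88 ∷ # 104 ∷ # 106 ∷ [])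
  ∷ (# 3 ∷ # 8 ∷ # 18 ∷ # 21 ∷ # 30 ∷ # 36 ∷ # 38 ∷ # 45 ∷ # 47 ∷ # 67 ∷ # 73 ∷ # 89 ∷ [])
  ∷ (# 11 ∷ # 27 ∷ # 62 ∷ # 64 ∷ # 72 ∷ # 78 ∷ # 80 ∷ # 84 ∷ # 96 ∷ # 98 ∷ # 100 ∷ # 102 ∷ [])
  ∷ (# 2 ∷ # 9 ∷ # 23 ∷ # 26 ∷ # 37 ∷ # 39 ∷ # 66 ∷ # 74 ∷ # 79 ∷ # 85 ∷ # 101 ∷ # 103 ∷ [])
  ∷ (# 7 ∷ # 15 ∷ # 27 ∷ # 41 ∷ # 43 ∷ # 62 ∷ # 68 ∷ # 76 ∷ # 81 ∷ # 84 ∷ # 96 ∷ # 98 ∷ [])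
  ∷ (# 2 ∷ # 5 ∷ # 13 ∷ # 22 ∷ # 26 ∷ # 37 ∷ # 39 ∷ # 40 ∷ # 42 ∷ # 70 ∷ # 77 ∷ # 85 ∷ [])
  ∷ (# 11 ∷ # 35 ∷ # 61 ∷ # 64 ∷ # 72 ∷ # 76 ∷ # 82 ∷ # 92 ∷ # 100 ∷ # 102 ∷ # 104 ∷ # 106 ∷ [])
  ∷ (# 1 ∷ # 7 ∷ # 15 ∷ # 34 ∷ # 41 ∷ # 43 ∷ # 68 ∷ # 78 ∷ # 83 ∷ # 93 ∷ # 105 ∷ # 107 ∷ [])
  ∷ (# 10 ∷ # 19 ∷ # 35 ∷ # 45 ∷ # 47 ∷ # 61 ∷ # 65 ∷ # 73 ∷ # 80 ∷ # 92 ∷ # 100 ∷ # 102 ∷ [])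
  ∷ (# 1 ∷ # 6 ∷ # 14 ∷ # 17 ∷ # 34 ∷ # 41 ∷ # 43 ∷ # 44 ∷ # 46 ∷ # 69 ∷ # 81 ∷ # 93 ∷ [])
  ∷ (# 43 ∷ # 62 ∷ # 64 ∷ # 68 ∷ # 76 ∷ # 78 ∷ # 86 ∷ # 96 ∷ # 100 ∷ # 108 ∷ # 116 ∷ # 118 ∷ [])
  ∷ (# 2 ∷ # 39 ∷ # 42 ∷ # 57 ∷ # 59 ∷ # 66 ∷ # 70 ∷ # 77 ∷ # 79 ∷ # 87 ∷ # 101 ∷ # 110 ∷ [])
  ∷ (# 17 ∷ # 19 ∷ # 43 ∷ # 51 ∷ # 62 ∷ # 65 ∷ # 69 ∷ # 84 ∷ # 97 ∷ # 100 ∷ # 116 ∷ # 118 ∷ [])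
  ∷ (# 2 ∷ # 16 ∷ # 18 ∷ # 38 ∷ # 42 ∷ # 49 ∷ # 57 ∷ # 59 ∷ # 67 ∷ # 71 ∷ # 85 ∷ # 101 ∷ [])
  ∷ (# 39 ∷ # 63 ∷ # 64 ∷ # 66 ∷ # 72 ∷ # 74 ∷ # 90 ∷ # 96 ∷ # 104 ∷ # 108 ∷ # 110 ∷ # 112 ∷ [])
  ∷ (# 3 ∷ # 38 ∷ # 47 ∷ # 49 ∷ # 51 ∷ # 65 ∷ # 67 ∷ # 73 ∷ # 75 ∷ # 91 ∷ # 97 ∷ # 114 ∷ [])
  ∷ (# 13 ∷ # 15 ∷ # 39 ∷ # 55 ∷ # 63 ∷ # 68 ∷ # 70 ∷ # 88 ∷ # 96 ∷ # 105 ∷ # 108 ∷ # 110 ∷ [])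
  ∷ (# 3 ∷ # 12 ∷ # 14 ∷ # 38 ∷ # 46 ∷ # 49 ∷ # 51 ∷ # 53 ∷ # 69 ∷ # 71 ∷ # 89 ∷ # 97 ∷ [])
  ∷ (# 47 ∷ # 61 ∷ # 64 ∷ # 65 ∷ # 80 ∷ # 82 ∷ # 94 ∷ # 100 ∷ # 104 ∷ # 112 ∷ # 114 ∷ # 116 ∷ [])
  ∷ (# 1 ∷ # 43 ∷ # 46 ∷ # 53 ∷ # 55 ∷ # 68 ∷ # 69 ∷ # 81 ∷ # 83 ∷ # 95 ∷ # 105 ∷ # 118 ∷ [])
  ∷ (# 21 ∷ # 23 ∷ # 47 ∷ # 59 ∷ # 61 ∷ # 66 ∷ # 67 ∷ # 92 ∷ # 101 ∷ # 104 ∷ # 112 ∷ # 114 ∷ [])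
  ∷ (# 1 ∷ # 20 ∷ # 22 ∷ # 42 ∷ # 46 ∷ # 53 ∷ # 55 ∷ # 57 ∷ # 70 ∷ # 71 ∷ # 93 ∷ # 105 ∷ [])
  ∷ (# 15 ∷ # 63 ∷ # 64 ∷ # 68 ∷ # 72 ∷ # 76 ∷ # 78 ∷ # 84 ∷ # 88 ∷ # 90 ∷ # 98 ∷ # 108 ∷ [])
  ∷ (# 3 ∷ # 14 ∷ # 17 ∷ # 19 ∷ # 51 ∷ # 65 ∷ # 69 ∷ # 73 ∷ # 86 ∷ # 89 ∷ # 91 ∷ # 99 ∷ [])
  ∷ (# 7 ∷ # 11 ∷ # 15 ∷ # 27 ∷ # 29 ∷ # 31 ∷ # 63 ∷ # 72 ∷ # 76 ∷ # 78 ∷ # 96 ∷ # 109 ∷ [])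
  ∷ (# 3 ∷ # 6 ∷ # 10 ∷ # 14 ∷ # 17 ∷ # 19 ∷ # 25 ∷ # 28 ∷ # 30 ∷ # 50 ∷ # 73 ∷ # 97 ∷ [])
  ∷ (# 19 ∷ # 62 ∷ # 64 ∷ # 65 ∷ # 76 ∷ # 80 ∷ # 82 ∷ # 84 ∷ # 86 ∷ # 92 ∷ # 102 ∷ # 116 ∷ [])
  ∷ (# 2 ∷ # 18 ∷ # 21 ∷ # 23 ∷ # 59 ∷ # 66 ∷ # 67 ∷ # 77 ∷ # 85 ∷ # 87 ∷ # 94 ∷ # 103 ∷ [])
  ∷ (# 10 ∷ # 11 ∷ # 19 ∷ # 25 ∷ # 27 ∷ # 35 ∷ # 62 ∷ # 76 ∷ # 80 ∷ # 82 ∷ # 100 ∷ # 117 ∷ [])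
  ∷ (# 2 ∷ # 8 ∷ # 9 ∷ # 18 ∷ # 21 ∷ # 23 ∷ # 24 ∷ # 26 ∷ # 33 ∷ # 58 ∷ # 77 ∷ # 101 ∷ [])
  ∷ (# 23 ∷ # 61 ∷ # 64 ∷ # 66 ∷ # 72 ∷ # 74 ∷ # 80 ∷ # 88 ∷ # 92 ∷ # 94 ∷ # 106 ∷ # 112 ∷ [])
  ∷ (# 1 ∷ # 13 ∷ # 15 ∷ # 22 ∷ # 55 ∷ # 68 ∷ # 70 ∷ # 81 ∷ # 90 ∷ # 93 ∷ # 95 ∷ # 107 ∷ [])
  ∷ (# 9 ∷ # 11 ∷ # 23 ∷ # 31 ∷ # 33 ∷ # 35 ∷ # 61 ∷ # 72 ∷ # 74 ∷ # 80 ∷ # 104 ∷ # 113 ∷ [])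
  ∷ (# 1 ∷ # 5 ∷ # 7 ∷ # 13 ∷ # 15 ∷ # 22 ∷ # 29 ∷ # 32 ∷ # 34 ∷ # 54 ∷ # 81 ∷ # 105 ∷ [])
  ∷ (# 55 ∷ # 60 ∷ # 64 ∷ # 68 ∷ # 84 ∷ # 88 ∷ # 90 ∷ # 96 ∷ # 110 ∷ # 112 ∷ # 116 ∷ # 118 ∷ [])
  ∷ (# 0 ∷ # 7 ∷ # 11 ∷ # 27 ∷ # 29 ∷ # 31 ∷ # 54 ∷ # 98 ∷ # 111 ∷ # 113 ∷ # 117 ∷ # 119 ∷ [])
  ∷ (# 39 ∷ # 55 ∷ # 57 ∷ # 59 ∷ # 60 ∷ # 66 ∷ # 70 ∷ # 85 ∷ # 88 ∷ # 90 ∷ # 108 ∷ # 112 ∷ [])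
  ∷ (# 0 ∷ # 5 ∷ # 9 ∷ # 26 ∷ # 29 ∷ # 31 ∷ # 37 ∷ # 54 ∷ # 56 ∷ # 58 ∷ # 109 ∷ # 113 ∷ [])
  ∷ (# 59 ∷ # 60 ∷ # 64 ∷ # 66 ∷ # 88 ∷ # 92 ∷ # 94 ∷ # 104 ∷ # 108 ∷ # 110 ∷ # 114 ∷ # 116 ∷ [])
  ∷ (# 0 ∷ # 9 ∷ # 11 ∷ # 31 ∷ # 33 ∷ # 35 ∷ # 58 ∷ # 106 ∷ # 109 ∷ # 111 ∷ # 115 ∷ # 117 ∷ [])
  ∷ (# 47 ∷ # 49 ∷ # 51 ∷ # 59 ∷ # 60 ∷ # 65 ∷ # 67 ∷ # 89 ∷ # 92 ∷ # 94 ∷ # 112 ∷ # 116 ∷ [])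
  ∷ (# 0 ∷ # 8 ∷ # 10 ∷ # 30 ∷ # 33 ∷ # 35 ∷ # 45 ∷ # 48 ∷ # 50 ∷ # 58 ∷ # 113 ∷ # 117 ∷ [])
  ∷ (# 51 ∷ # 60 ∷ # 64 ∷ # 65 ∷ # 84 ∷ # 86 ∷ # 92 ∷ # 100 ∷ # 108 ∷ # 112 ∷ # 114 ∷ # 118 ∷ [])
  ∷ (# 0 ∷ # 10 ∷ # 11 ∷ # 25 ∷ # 27 ∷ # 35 ∷ # 50 ∷ # 102 ∷ # 109 ∷ # 113 ∷ # 115 ∷ # 119 ∷ [])
  ∷ (# 43 ∷ # 51 ∷ # 53 ∷ # 55 ∷ # 60 ∷ # 68 ∷ # 69 ∷ # 84 ∷ # 86 ∷ # 93 ∷ # 108 ∷ # 116 ∷ [])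
  ∷ (# 0 ∷ # 6 ∷ # 7 ∷ # 25 ∷ # 27 ∷ # 34 ∷ # 41 ∷ # 50 ∷ # 52 ∷ # 54 ∷ # 109 ∷ # 117 ∷ [])
  ∷ []

neighborsΠ-adjacent : ∀ v → All (Adj Π v) (lookup neighborsΠ v)
neighborsΠ-adjacent = decided (FP.all? λ v → All.all? (adjacentΠ? v) (lookup neighborsΠ v)) refl

open ColoringSearch Π 5 neighborsΠ neighborsΠ-adjacent

Antipodal : (Fin nΠ → Fin 5) → Set
Antipodal f = ∀ i → f (i ↑ˡ nP) ≡ f (nP ↑ʳ i)

antipodalAt? : PartialColoring → Fin nP → Bool
antipodalAt? K i = sameKnownColor (lookup K (i ↑ˡ nP)) (lookup K (nP ↑ʳ i))

antipodal? : PartialColoring → Bool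
antipodal? K = all (antipodalAt? K) (allFin nP)

antipodal?-sound : ∀ {f} K → f Extends K → T (antipodal? K) → Antipodal f
antipodal?-sound K ext ok i =
  sameKnownColor-sound {K = K} ext (i ↑ˡ nP) (nP ↑ʳ i) (all-allFin (antipodalAt? K) ok i)

tetrahedron : Fin 4 → Fin nΠ
tetrahedron = lookup (# 0 ∷ # 48 ∷ # 50 ∷ # 52 ∷ [])

tetrahedron-clique : ∀ i j → i ≢ j → Adj Π (tetrahedron i) (tetrahedron j)
tetrahedron-clique = decided (FP.all? λ i → FP.all? λ j →
                                 ¬? (i F.≟ j) →-dec adjacentΠ? (tetrahedron i) (tetrahedron j)) refl

-- Greedy order: each vertex has as many earlier neighbors as possible.
searchOrder : List (Fin nΠ)
searchOrder =
  # 28 ∷ # 4 ∷ # 56 ∷ # 6 ∷ # 44 ∷ # 32 ∷ # 34 ∷ # 54 ∷ # 119 ∷ # 1 ∷ # 20 ∷ # 12 ∷ # 14 ∷ # 46 ∷ # 83 ∷ # 36 ∷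
  # 3 ∷ # 30 ∷ # 99 ∷ # 16 ∷ # 24 ∷ # 40 ∷ # 5 ∷ # 22 ∷ # 107 ∷ # 7 ∷ # 41 ∷ # 81 ∷ # 17 ∷ # 25 ∷ # 8 ∷ # 58 ∷
  # 115 ∷ # 10 ∷ # 117 ∷ # 26 ∷ # 111 ∷ # 109 ∷ # 27 ∷ # 29 ∷ # 113 ∷ # 2 ∷ # 18 ∷ # 103 ∷ # 9 ∷ # 33 ∷ # 31 ∷ # 37 ∷
  # 79 ∷ # 13 ∷ # 42 ∷ # 77 ∷ # 11 ∷ # 35 ∷ # 45 ∷ # 75 ∷ # 21 ∷ # 38 ∷ # 71 ∷ # 73 ∷ # 87 ∷ # 91 ∷ # 95 ∷ # 97 ∷
  # 19 ∷ # 102 ∷ # 62 ∷ # 69 ∷ # 43 ∷ # 93 ∷ # 105 ∷ # 15 ∷ # 78 ∷ # 98 ∷ # 53 ∷ # 63 ∷ # 68 ∷ # 70 ∷ # 39 ∷ # 85 ∷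
  # 57 ∷ # 55 ∷ # 90 ∷ # 101 ∷ # 23 ∷ # 74 ∷ # 106 ∷ # 49 ∷ # 67 ∷ # 89 ∷ # 47 ∷ # 61 ∷ # 82 ∷ # 51 ∷ # 65 ∷ # 86 ∷
  # 118 ∷ # 59 ∷ # 60 ∷ # 110 ∷ # 66 ∷ # 94 ∷ # 114 ∷ # 72 ∷ # 76 ∷ # 80 ∷ # 96 ∷ # 84 ∷ # 100 ∷ # 88 ∷ # 104 ∷ # 92 ∷
  # 64 ∷ # 108 ∷ # 112 ∷ # 116 ∷ []

initial : PartialColoring
initial = seed tetrahedron F.inject₁

search-succeeds : everyExtension antipodal? searchOrder initial ≡ true
search-succeeds = refl

normalized-coloring-antipodal : ∀ {g} → Proper Π g → (∀ i → g (tetrahedron i) ≡ F.inject₁ i) → Antipodal g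
normalized-coloring-antipodal proper g-tetrahedron =
  search-sound proper searchOrder initial (extends-seed tetrahedron F.inject₁ g-tetrahedron) search-succeeds
  where
  -- stated for arbitrary vs and K: instantiating everyExtension-sound directly at the
  -- concrete arguments makes Agda evaluate the search once more during elaboration
  search-sound : ∀ {f} → Proper Π f → ∀ vs K → f Extends K → everyExtension antipodal? vs K ≡ true → Antipodal f
  search-sound = everyExtension-sound Antipodal antipodal? antipodal?-sound

coloring-antipodal : ∀ {f} → Proper Π f → Antipodal f
coloring-antipodal {f} proper i =
  ⟨$⟩ʳ-injective ρ (normalized-coloring-antipodal ρ∘f-proper ρ∘f-tetrahedron i)
  where
  relabeling : Σ (Permutation′ 5) λ ρ → ∀ i → ρ ⟨$⟩ʳ f (tetrahedron i) ≡ F.inject₁ i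
  relabeling = permutation-extending (f ∘ tetrahedron) F.inject₁
                  (proper-injective-on-clique Π proper tetrahedron tetrahedron-clique) FP.inject₁-injective
  ρ : Permutation′ 5
  ρ = proj₁ relabeling
  ρ∘f-proper : Proper Π ((ρ ⟨$⟩ʳ_) ∘ f)
  ρ∘f-proper u v a = proper u v a ∘ ⟨$⟩ʳ-injective ρ
  ρ∘f-tetrahedron : ∀ i → ρ ⟨$⟩ʳ f (tetrahedron i) ≡ F.inject₁ i
  ρ∘f-tetrahedron = proj₂ relabeling

sheet : Fin nP → Fin nΠ
sheet i = i ↑ˡ nP

cover-join : ∀ s → cover (F.join nP nP s) ≡ [ id , id ]′ s
cover-join s = cong [ id , id ]′ (FP.splitAt-join nP nP s)

factors-through-cover : ∀ {f} → Antipodal f → ∀ u → f u ≡ f (sheet (cover u))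
factors-through-cover {f} antipodal u =
  subst (λ u → f u ≡ f (sheet (cover u))) (FP.join-splitAt nP nP u) (on-join (F.splitAt nP u))
  where
  on-join : ∀ s → f (F.join nP nP s) ≡ f (sheet (cover (F.join nP nP s)))
  on-join (inj₁ i) rewrite cover-join (inj₁ i) = refl
  on-join (inj₂ i) rewrite cover-join (inj₂ i) = sym (antipodal i)

liftColoring : FiveColoring P → FiveColoring Π
liftColoring (h , h-proper) = h ∘ cover , λ u v a → h-proper (cover u) (cover v) (u , v , refl , refl , a)

descendColoring : FiveColoring Π → FiveColoring P
descendColoring (f , f-proper) = f ∘ sheet , proper
  where
  factors : ∀ u → f u ≡ f (sheet (cover u))
  factors = factors-through-cover (coloring-antipodal f-proper)
  proper : Proper P (f ∘ sheet)
  proper _ _ (u , v , refl , refl , a) e = f-proper u v a (trans (factors u) (trans e (sym (factors v))))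

lift∘descend : ∀ f u → proj₁ (liftColoring (descendColoring f)) u ≡ proj₁ f u
lift∘descend (f , f-proper) u = sym (factors-through-cover (coloring-antipodal f-proper) u)

colorClass-cong : ∀ G (f g : FiveColoring G) → (∀ v → proj₁ f v ≡ proj₁ g v) →
                  ∀ c → colorClass G f c ≡ colorClass G g c
colorClass-cong G f g f≗g c = VecP.tabulate-cong (λ v → cong (λ x → does (x F.≟ c)) (f≗g v))

preimage-colorClass : ∀ h c → preimage (colorClass P h c) ≡ colorClass Π (liftColoring h) c
preimage-colorClass (h , _) c =
  VecP.tabulate-cong (λ v → VecP.lookup∘tabulate (λ i → does (h i F.≟ c)) (cover v))

colorClass-descend : ∀ f c → colorClass Π f c ≡ preimage (colorClass P (descendColoring f) c)
colorClass-descend f c = begin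
  colorClass Π f c                               ≡⟨ colorClass-cong Π f f↑ (sym ∘ lift∘descend f) c ⟩
  colorClass Π f↑ c                              ≡⟨ preimage-colorClass (descendColoring f) c ⟨
  preimage (colorClass P (descendColoring f) c)  ∎
  where
  open ≡-Reasoning
  f↑ : FiveColoring Π
  f↑ = liftColoring (descendColoring f)

preimage-injective : ∀ S S′ → preimage S ≡ preimage S′ → S ≡ S′
preimage-injective S S′ e = begin
  S                                     ≡⟨ VecP.tabulate∘lookup S ⟨
  tabulate (lookup S)                   ≡⟨ VecP.tabulate-cong lookup-sheet ⟩
  tabulate (lookup S′)                  ≡⟨ VecP.tabulate∘lookup S′ ⟩
  S′                                    ∎
  where
  open ≡-Reasoning
  lookup-preimage : ∀ T i → lookup (preimage T) (sheet i) ≡ lookup T i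
  lookup-preimage T i =
    trans (VecP.lookup∘tabulate (lookup T ∘ cover) (sheet i)) (cong (lookup T) (cover-join (inj₁ i)))
  lookup-sheet : ∀ i → lookup S i ≡ lookup S′ i
  lookup-sheet i =
    trans (sym (lookup-preimage S i)) (trans (cong (λ T → lookup T (sheet i)) e) (lookup-preimage S′ i))

facet-lift : ∀ σ → BFacet P σ → BFacet Π (imageSet σ)
facet-lift σ (h , σ⇔) = liftColoring h , λ T → mk⇔ to from
  where
  to : ∀ {T} → imageSet σ T → ∃[ c ] T ≡ colorClass Π (liftColoring h) c
  to (S , σS , refl) = let c , S≡ = Equivalence.to (σ⇔ S) σS
                       in c , trans (cong preimage S≡) (preimage-colorClass h c)
  from : ∀ {T} → ∃[ c ] T ≡ colorClass Π (liftColoring h) c → imageSet σ T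
  from (c , refl) = colorClass P h c , Equivalence.from (σ⇔ _) (c , refl) , preimage-colorClass h c

facet-descend : ∀ σ → BFacet Π (imageSet σ) → BFacet P σ
facet-descend σ (f , image⇔) = descendColoring f , λ S → mk⇔ to from
  where
  is-class : ∀ {S c} → preimage S ≡ colorClass Π f c → S ≡ colorClass P (descendColoring f) c
  is-class {c = c} e = preimage-injective _ _ (trans e (colorClass-descend f c))
  to : ∀ {S} → σ S → ∃[ c ] S ≡ colorClass P (descendColoring f) c
  to {S} σS = let c , e = Equivalence.to (image⇔ (preimage S)) (S , σS , refl) in c , is-class e
  from : ∀ {S} → ∃[ c ] S ≡ colorClass P (descendColoring f) c → σ S
  from (c , refl) = let S′ , σS′ , e = Equivalence.from (image⇔ (colorClass Π f c)) (c , refl)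
                    in subst σ (is-class e) σS′

mainTheorem6 : InducedIsoB
mainTheorem6 = record
  { vertex-map  = λ { _ (h , c , refl) → liftColoring h , c , preimage-colorClass h c }
  ; vertex-inj  = λ S S′ _ _ → preimage-injective S S′
  ; vertex-surj = λ { _ (f , c , refl) → colorClass P (descendColoring f) c , (descendColoring f , c , refl)
                                         , sym (colorClass-descend f c) }
  ; facet-iff   = λ σ _ → mk⇔ (facet-lift σ) (facet-descend σ)
  }
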